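{- Let $\Gamma$ be a typing context, $x$ a variable with $x\notin\Gamma$, $m\ge0$, and $A_1,\dots,A_m$ types with $A_i\neq A_j$ for $i\neq j$. If $\Gamma,x:A_1,\dots,x:A_m\vdash_s P:B$ is derivable in $\Lambda_\cap^s$ and $\Gamma\vdash_s N:A_i$ is derivable for every $i\in\{1,\dots,m\}$, then $\Gamma\vdash_s P[x:=N]:B$ is derivable in $\Lambda_\cap^s$.
   Context: $\lambda$-terms: $M::=x\mid MM\mid\lambda x.M$ modulo $\alpha$-conversion; $M[x:=N]$ capture-avoiding substitution. Types: $A::=\varphi\mid A\to A\mid A\cap A$. A typing context is a finite set of pairs $x:A$, where a variable may occur with several types; $\Gamma,x:A$ denotes $\Gamma\cup\{x:A\}$; $x\notin\Gamma$ means no $x:C$ lies in $\Gamma$. Rules of $\Lambda_\cap^s$ ($n\ge0$): (Ax) $\Gamma,x:A\vdash_s x:A$; $(\mathsf{Beta})^s$ from $\Gamma\vdash_s M[x:=N]N_1\dots N_n:A$ and $\Gamma\vdash_s N:B$ infer $\Gamma\vdash_s(\lambda x.M)NN_1\dots N_n:A$; $(\mathsf{L}\to)$ from $\Gamma\vdash_s N:A_1$ and $\Gamma,y:A_2\vdash_s yN_1\dots N_n:B$, with $y\notin FV(N_1)\cup\dots\cup FV(N_n)$, $y\notin\Gamma$, infer $\Gamma,x:A_1\to A_2\vdash_s xNN_1\dots N_n:B$; $(\mathsf{R}\to)$ from $\Gamma,x:A\vdash_s M:B$, $x\notin\Gamma$, infer $\Gamma\vdash_s\lambda x.M:A\to B$;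 $(\mathsf{L}\cap)$ from $\Gamma,x:A_1,x:A_2\vdash_s xN_1\dots N_n:B$ infer $\Gamma,x:A_1\cap A_2\vdash_s xN_1\dots N_n:B$; $(\mathsf{R}\cap)$ from $\Gamma\vdash_s M:A$ and $\Gamma\vdash_s M:B$ infer $\Gamma\vdash_s M:A\cap B$. -}

module Defs where

open import Data.Nat using (ℕ; zero; suc; _≟_)
open import Data.Fin using (Fin; zero; suc)
open import Data.List using (List; []; _∷_; _++_; [_])
open import Data.List.Membership.Propositional using (_∈_; _∉_)
open import Data.List.Relation.Unary.All using (All)
open import Data.Product using (_×_; _,_)
open import Relation.Nullary using (¬_; yes; no)
open import Function using (_⇔_)

-- λ-terms modulo α-conversion, locally nameless and well scoped:
-- free variables are names (ℕ), bound variables are de Bruijn indices.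
-- Term 0 is exactly the set of λ-terms modulo α.

data Term (n : ℕ) : Set where
  bvar : Fin n → Term n
  fvar : ℕ → Term n
  app  : Term n → Term n → Term n
  lam  : Term (suc n) → Term n

extR : ∀ {n m} → (Fin n → Fin m) → Fin (suc n) → Fin (suc m)
extR ρ zero    = zero
extR ρ (suc i) = suc (ρ i)

ren : ∀ {n m} → (Fin n → Fin m) → Term n → Term m
ren ρ (bvar i)  = bvar (ρ i)
ren ρ (fvar x)  = fvar x
ren ρ (app M N) = app (ren ρ M) (ren ρ N)
ren ρ (lam M)   = lam (ren (extR ρ) M)

extS : ∀ {n m} → (Fin n → Term m) → Fin (suc n) → Term (suc m)
extS σ zero    = bvar zero
extS σ (suc i) = ren suc (σ i)

bsub : ∀ {n m} → (Fin n → Term m) → Term n → Term m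
bsub σ (bvar i)  = σ i
bsub σ (fvar x)  = fvar x
bsub σ (app M N) = app (bsub σ M) (bsub σ N)
bsub σ (lam M)   = lam (bsub (extS σ) M)

-- If  lam M  represents  λx.M' , then  inst M N  represents  M'[x:=N].
inst : Term 1 → Term 0 → Term 0
inst M N = bsub (λ _ → N) M

-- opening a body with a free name x:  λx.M'  with  M' = open M x
openT : Term 1 → ℕ → Term 0
openT M x = inst M (fvar x)

weaken0 : ∀ {n} → Term 0 → Term n
weaken0 = ren (λ ())

-- capture-avoiding substitution M[x:=N] for a free variable x
-- (capture is impossible: bound variables are indices, N is closed under binders)
fsub : ∀ {n} → ℕ → Term 0 → Term n → Term n
fsub x N (bvar i) = bvar i
fsub x N (fvar y) with x ≟ y
... | yes _ = weaken0 N
... | no  _ = fvar y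
fsub x N (app M L) = app (fsub x N M) (fsub x N L)
fsub x N (lam M)   = lam (fsub x N M)

FV : ∀ {n} → Term n → List ℕ
FV (bvar i)  = []
FV (fvar x)  = [ x ]
FV (app M N) = FV M ++ FV N
FV (lam M)   = FV M

infixl 5 _·*_
_·*_ : Term 0 → List (Term 0) → Term 0
M ·* []       = M
M ·* (N ∷ Ns) = app M N ·* Ns

infixr 7 _⇒_
infixl 8 _∩_
data Ty : Set where
  atom : ℕ → Ty
  _⇒_  : Ty → Ty → Ty
  _∩_  : Ty → Ty → Ty

-- Typing contexts: finite sets of pairs x:A, represented by lists,
-- used only up to membership (set equality ≋).

Ctx : Set
Ctx = List (ℕ × Ty)

_≋_ : Ctx → Ctx → Set
Δ ≋ Γ = ∀ p → (p ∈ Δ) ⇔ (p ∈ Γ)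

_∉dom_ : ℕ → Ctx → Set
x ∉dom Γ = ∀ C → (x , C) ∉ Γ

-- The system Λ∩ˢ.  Each rule whose conclusion context is "Γ, x:A"
-- (= Γ ∪ {x:A}) is stated for any list Δ that is set-equal to (x , A) ∷ Γ.

infix 4 _⊢s_∶_
data _⊢s_∶_ : Ctx → Term 0 → Ty → Set where
  Ax   : ∀ {Δ x A} → (x , A) ∈ Δ → Δ ⊢s fvar x ∶ A
  Beta : ∀ {Γ M N Ns A B} →
         Γ ⊢s inst M N ·* Ns ∶ A →
         Γ ⊢s N ∶ B →
         Γ ⊢s app (lam M) N ·* Ns ∶ A
  L⇒   : ∀ {Δ Γ x y N Ns A₁ A₂ B} →
         Δ ≋ ((x , A₁ ⇒ A₂) ∷ Γ) →
         Γ ⊢s N ∶ A₁ →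
         ((y , A₂) ∷ Γ) ⊢s fvar y ·* Ns ∶ B →
         All (λ L → y ∉ FV L) Ns →
         y ∉dom Γ →
         Δ ⊢s app (fvar x) N ·* Ns ∶ B
  -- λx.M' with representative name x: x ∉ FV(λ-term), M' = openT M x
  R⇒   : ∀ {Γ x M A B} →
         x ∉ FV (lam M) →
         ((x , A) ∷ Γ) ⊢s openT M x ∶ B →
         x ∉dom Γ →
         Γ ⊢s lam M ∶ A ⇒ B
  L∩   : ∀ {Δ Γ x Ns A₁ A₂ B} →
         Δ ≋ ((x , A₁ ∩ A₂) ∷ Γ) →
         ((x , A₁) ∷ (x , A₂) ∷ Γ) ⊢s fvar x ·* Ns ∶ B →
         Δ ⊢s fvar x ·* Ns ∶ B
  R∩   : ∀ {Γ M A B} →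
         Γ ⊢s M ∶ A →
         Γ ⊢s M ∶ B →
         Γ ⊢s M ∶ A ∩ B

-- Substitution is cut admissibility for this sequent calculus, proved by induction on the size of
-- the cut type. The only hard case is a hypothesis x : A₁ ⇒ A₂ used by L⇒ in  x K Ns : B  with a
-- fresh y : A₂ ⊢ y Ns : B.  After substitution we must type  N K′ Ns′ : B,  i.e. cut  N K′ : A₂
-- into y, which needs the admissibility of application  N K′ : A₂.  If N is an abstraction λz.M
-- this in turn is a cut of K′ into z : A₁.  Both new cuts are at types smaller than A₁ ⇒ A₂.
--
-- The calculus is first replaced by an equivalent one in which the eigenvariables of L⇒ and R⇒
-- range over all names outside a finite set, which makes the fresh-name bookkeeping routine.

module Submission where

open import Defs
open import Data.Nat using (ℕ; suc; _≟_; _+_; _≤_; s≤s)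
open import Data.Nat.Properties using (≤-trans; m≤m+n; m≤n+m; n≤1+n; <-irrefl)
open import Data.Fin using (Fin; zero; suc)
open import Data.List using (List; []; _∷_; map; _++_; _∷ʳ_; concatMap)
open import Data.List.Extrema.Nat using (max; xs≤max)
open import Data.List.Membership.Propositional using (_∈_; _∉_)
open import Data.List.Membership.Propositional.Properties
  using (∈-map⁺; ∈-map⁻; ∈-++⁺ˡ; ∈-++⁺ʳ; ∈-++⁻; ∈-concatMap⁺)
open import Data.List.Relation.Unary.Any using (here; there)
open import Data.List.Relation.Unary.All as All using (All; []; _∷_)
open import Data.List.Relation.Unary.All.Properties using (¬Any⇒All¬)
open import Data.List.Relation.Unary.Unique.Propositional using (Unique)
open import Data.List.Relation.Binary.Subset.Propositional using (_⊆_)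
open import Data.List.Relation.Binary.Subset.Propositional.Properties using (∷⁺ʳ)
open import Data.Product using (_,_; _×_; proj₁; proj₂)
open import Data.Sum using (_⊎_; inj₁; inj₂)
open import Data.Empty using (⊥-elim)
open import Relation.Nullary using (yes; no)
open import Relation.Binary.PropositionalEquality
  using (_≡_; _≢_; refl; sym; trans; cong; cong₂; subst)
open import Function using (_∘_; mk⇔)
open import Function.Bundles using (Equivalence)
open Equivalence using (from)

extR-id : ∀ {n} {ρ : Fin n → Fin n} → (∀ i → ρ i ≡ i) → ∀ i → extR ρ i ≡ i
extR-id h zero    = refl
extR-id h (suc i) = cong suc (h i)

extR-∘ : ∀ {k n m} {ρ : Fin n → Fin m} {ρ₁ : Fin k → Fin n} {ρ₂ : Fin k → Fin m} →
         (∀ i → ρ (ρ₁ i) ≡ ρ₂ i) → ∀ i → extR ρ (extR ρ₁ i) ≡ extR ρ₂ i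
extR-∘ h zero    = refl
extR-∘ h (suc i) = cong suc (h i)

ren-id : ∀ {n} {ρ : Fin n → Fin n} → (∀ i → ρ i ≡ i) → (M : Term n) → ren ρ M ≡ M
ren-id h (bvar i)  = cong bvar (h i)
ren-id h (fvar x)  = refl
ren-id h (app M N) = cong₂ app (ren-id h M) (ren-id h N)
ren-id h (lam M)   = cong lam (ren-id (extR-id h) M)

ren-∘ : ∀ {k n m} {ρ : Fin n → Fin m} {ρ₁ : Fin k → Fin n} {ρ₂ : Fin k → Fin m} →
        (∀ i → ρ (ρ₁ i) ≡ ρ₂ i) → (M : Term k) → ren ρ (ren ρ₁ M) ≡ ren ρ₂ M
ren-∘ h (bvar i)  = cong bvar (h i)
ren-∘ h (fvar x)  = refl
ren-∘ h (app M N) = cong₂ app (ren-∘ h M) (ren-∘ h N)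
ren-∘ h (lam M)   = cong lam (ren-∘ (extR-∘ h) M)

bsub-ren : ∀ {k n m} {τ : Fin n → Term m} {ρ : Fin k → Fin n} {ρ′ : Fin k → Fin m} →
           (∀ i → τ (ρ i) ≡ bvar (ρ′ i)) → (M : Term k) → bsub τ (ren ρ M) ≡ ren ρ′ M
bsub-ren h (bvar i)  = h i
bsub-ren h (fvar x)  = refl
bsub-ren h (app M N) = cong₂ app (bsub-ren h M) (bsub-ren h N)
bsub-ren {τ = τ} {ρ} {ρ′} h (lam M) = cong lam (bsub-ren h′ M)
  where
  h′ : ∀ i → extS τ (extR ρ i) ≡ bvar (extR ρ′ i)
  h′ zero    = refl
  h′ (suc i) = cong (ren suc) (h i)

fsub-ren : ∀ {n m} x K (ρ : Fin n → Fin m) (M : Term n) →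
           fsub x K (ren ρ M) ≡ ren ρ (fsub x K M)
fsub-ren x K ρ (bvar i) = refl
fsub-ren x K ρ (fvar y) with x ≟ y
... | yes _ = sym (ren-∘ (λ ()) K)
... | no _  = refl
fsub-ren x K ρ (app M N) = cong₂ app (fsub-ren x K ρ M) (fsub-ren x K ρ N)
fsub-ren x K ρ (lam M)   = cong lam (fsub-ren x K (extR ρ) M)

fsub-bsub : ∀ {n m} x K {σ τ : Fin n → Term m} → (∀ i → τ i ≡ fsub x K (σ i)) →
            (M : Term n) → fsub x K (bsub σ M) ≡ bsub τ (fsub x K M)
fsub-bsub x K h (bvar i) = sym (h i)
fsub-bsub x K h (fvar y) with x ≟ y
... | yes _ = sym (bsub-ren (λ ()) K)
... | no _  = refl
fsub-bsub x K h (app M N) = cong₂ app (fsub-bsub x K h M) (fsub-bsub x K h N)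
fsub-bsub x K {σ} {τ} h (lam M) = cong lam (fsub-bsub x K h′ M)
  where
  h′ : ∀ i → extS τ i ≡ fsub x K (extS σ i)
  h′ zero    = refl
  h′ (suc i) = trans (cong (ren suc) (h i)) (sym (fsub-ren x K suc (σ i)))

fsub-inst : ∀ x K M N → fsub x K (inst M N) ≡ inst (fsub x K M) (fsub x K N)
fsub-inst x K M N = fsub-bsub x K (λ _ → refl) M

fsub-fresh : ∀ {n} x K (M : Term n) → x ∉ FV M → fsub x K M ≡ M
fsub-fresh x K (bvar i) x∉ = refl
fsub-fresh x K (fvar y) x∉ with x ≟ y
... | yes x≡y = ⊥-elim (x∉ (here x≡y))
... | no _    = refl
fsub-fresh x K (app M N) x∉ =
  cong₂ app (fsub-fresh x K M (x∉ ∘ ∈-++⁺ˡ)) (fsub-fresh x K N (x∉ ∘ ∈-++⁺ʳ (FV M)))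
fsub-fresh x K (lam M) x∉ = cong lam (fsub-fresh x K M x∉)

fsub-fresh* : ∀ x K {Ns : List (Term 0)} → All (λ L → x ∉ FV L) Ns → map (fsub x K) Ns ≡ Ns
fsub-fresh* x K {[]}     []         = refl
fsub-fresh* x K {N ∷ Ns} (x∉ ∷ x∉s) = cong₂ _∷_ (fsub-fresh x K N x∉) (fsub-fresh* x K x∉s)

fsub-self : ∀ x K → fsub x K (fvar x) ≡ K
fsub-self x K with x ≟ x
... | yes _ = ren-id (λ ()) K
... | no x≢x = ⊥-elim (x≢x refl)

fsub-other : ∀ {x y} K → y ≢ x → fsub {0} x K (fvar y) ≡ fvar y
fsub-other {x} {y} K y≢x with x ≟ y
... | yes x≡y = ⊥-elim (y≢x (sym x≡y))
... | no _    = refl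

fsub-·* : ∀ x K M Ns → fsub x K (M ·* Ns) ≡ fsub x K M ·* map (fsub x K) Ns
fsub-·* x K M []       = refl
fsub-·* x K M (N ∷ Ns) = fsub-·* x K (app M N) Ns

fsub-self·* : ∀ x K Ns → fsub x K (fvar x ·* Ns) ≡ K ·* map (fsub x K) Ns
fsub-self·* x K Ns =
  trans (fsub-·* x K (fvar x) Ns) (cong (_·* map (fsub x K) Ns) (fsub-self x K))

fsub-self·*-fresh : ∀ x K Ns → All (λ L → x ∉ FV L) Ns → fsub x K (fvar x ·* Ns) ≡ K ·* Ns
fsub-self·*-fresh x K Ns x∉Ns =
  trans (fsub-self·* x K Ns) (cong (K ·*_) (fsub-fresh* x K x∉Ns))

fsub-other·* : ∀ {x y} K Ns → y ≢ x → fsub x K (fvar y ·* Ns) ≡ fvar y ·* map (fsub x K) Ns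
fsub-other·* {x} {y} K Ns y≢x =
  trans (fsub-·* x K (fvar y) Ns) (cong (_·* map (fsub x K) Ns) (fsub-other K y≢x))

fsub-openT-self : ∀ x K M → x ∉ FV M → fsub x K (openT M x) ≡ inst M K
fsub-openT-self x K M x∉ =
  trans (fsub-inst x K M (fvar x)) (cong₂ inst (fsub-fresh x K M x∉) (fsub-self x K))

fsub-openT-other : ∀ {x y} K M → y ≢ x → fsub x K (openT M y) ≡ openT (fsub x K M) y
fsub-openT-other {x} {y} K M y≢x =
  trans (fsub-inst x K M (fvar y)) (cong (inst (fsub x K M)) (fsub-other K y≢x))

·*-∷ʳ : ∀ M Ns L → app (M ·* Ns) L ≡ M ·* (Ns ∷ʳ L)
·*-∷ʳ M []       L = refl
·*-∷ʳ M (N ∷ Ns) L = ·*-∷ʳ (app M N) Ns L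

dom : Ctx → List ℕ
dom = map proj₁

∉dom-≢ : ∀ {x y C Γ} → x ∉dom Γ → (y , C) ∈ Γ → y ≢ x
∉dom-≢ x∉ q refl = x∉ _ q

fresh : List ℕ → ℕ
fresh xs = suc (max 0 xs)

fresh∉ : ∀ xs → fresh xs ∉ xs
fresh∉ xs p = <-irrefl refl (All.lookup (xs≤max 0 xs) p)

record FreshName (L : List ℕ) (Γ : Ctx) (Ms : List (Term 0)) : Set where
  field
    name     : ℕ
    name∉    : name ∉ L
    name∉dom : name ∉dom Γ
    name∉FV  : All (λ M → name ∉ FV M) Ms

freshName : ∀ L Γ Ms → FreshName L Γ Ms
freshName L Γ Ms = record
  { name     = fresh ws
  ; name∉    = fresh∉ ws ∘ ∈-++⁺ˡ
  ; name∉dom = λ _ → fresh∉ ws ∘ ∈-++⁺ʳ L ∘ ∈-++⁺ˡ ∘ ∈-map⁺ proj₁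
  ; name∉FV  = ¬Any⇒All¬ Ms (fresh∉ ws ∘ ∈-++⁺ʳ L ∘ ∈-++⁺ʳ (dom Γ) ∘ ∈-concatMap⁺ FV)
  }
  where ws = L ++ dom Γ ++ concatMap FV Ms

-- The cofinitely quantified calculus

size : Ty → ℕ
size (atom _) = 1
size (A ⇒ B)  = suc (size A + size B)
size (A ∩ B)  = suc (size A + size B)

infix 4 _⊩_∶_
data _⊩_∶_ : Ctx → Term 0 → Ty → Set where
  ax   : ∀ {Γ x A} → (x , A) ∈ Γ → Γ ⊩ fvar x ∶ A
  beta : ∀ {Γ M N Ns A B} → Γ ⊩ inst M N ·* Ns ∶ A → Γ ⊩ N ∶ B →
         Γ ⊩ app (lam M) N ·* Ns ∶ A
  l⇒   : ∀ {Γ x N Ns A₁ A₂ B} → (x , A₁ ⇒ A₂) ∈ Γ → Γ ⊩ N ∶ A₁ → (L : List ℕ) →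
         (∀ y → y ∉ L → ((y , A₂) ∷ Γ) ⊩ fvar y ·* Ns ∶ B) →
         Γ ⊩ app (fvar x) N ·* Ns ∶ B
  r⇒   : ∀ {Γ M A B} → (L : List ℕ) → (∀ y → y ∉ L → ((y , A) ∷ Γ) ⊩ openT M y ∶ B) →
         Γ ⊩ lam M ∶ A ⇒ B
  l∩   : ∀ {Γ x Ns A₁ A₂ B} → (x , A₁ ∩ A₂) ∈ Γ →
         ((x , A₁) ∷ (x , A₂) ∷ Γ) ⊩ fvar x ·* Ns ∶ B → Γ ⊩ fvar x ·* Ns ∶ B
  r∩   : ∀ {Γ M A B} → Γ ⊩ M ∶ A → Γ ⊩ M ∶ B → Γ ⊩ M ∶ A ∩ B

cast : ∀ {Γ M M′ A} → M ≡ M′ → Γ ⊩ M ∶ A → Γ ⊩ M′ ∶ A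
cast {Γ} {A = A} = subst (λ M → Γ ⊩ M ∶ A)

weaken : ∀ {Γ Γ′ M A} → Γ ⊆ Γ′ → Γ ⊩ M ∶ A → Γ′ ⊩ M ∶ A
weaken Γ⊆ (ax m) = ax (Γ⊆ m)
weaken Γ⊆ (beta {M = M} {Ns = Ns} d e) = beta {M = M} {Ns = Ns} (weaken Γ⊆ d) (weaken Γ⊆ e)
weaken Γ⊆ (l⇒ {Ns = Ns} m d L f) =
  l⇒ {Ns = Ns} (Γ⊆ m) (weaken Γ⊆ d) L (λ y y∉ → weaken (∷⁺ʳ _ Γ⊆) (f y y∉))
weaken Γ⊆ (r⇒ L f) = r⇒ L (λ y y∉ → weaken (∷⁺ʳ _ Γ⊆) (f y y∉))
weaken Γ⊆ (l∩ {Ns = Ns} m d) = l∩ {Ns = Ns} (Γ⊆ m) (weaken (∷⁺ʳ _ (∷⁺ʳ _ Γ⊆)) d)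
weaken Γ⊆ (r∩ d e) = r∩ (weaken Γ⊆ d) (weaken Γ⊆ e)

∩-inv : ∀ {Γ N A₁ A₂} → Γ ⊩ N ∶ A₁ ∩ A₂ → (Γ ⊩ N ∶ A₁) × (Γ ⊩ N ∶ A₂)
∩-inv (ax m) = l∩ {Ns = []} m (ax (here refl)) , l∩ {Ns = []} m (ax (there (here refl)))
∩-inv (beta {M = M} {Ns = Ns} d e) =
  beta {M = M} {Ns = Ns} (proj₁ (∩-inv d)) e , beta {M = M} {Ns = Ns} (proj₂ (∩-inv d)) e
∩-inv (l⇒ {Ns = Ns} m d L f) =
  l⇒ {Ns = Ns} m d L (λ y y∉ → proj₁ (∩-inv (f y y∉))) ,
  l⇒ {Ns = Ns} m d L (λ y y∉ → proj₂ (∩-inv (f y y∉)))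
∩-inv (l∩ {Ns = Ns} m d) = l∩ {Ns = Ns} m (proj₁ (∩-inv d)) , l∩ {Ns = Ns} m (proj₂ (∩-inv d))
∩-inv (r∩ d e) = d , e

SubstCtx : Ctx → Ctx → ℕ → Term 0 → Set
SubstCtx Δ Γ x N = ∀ {y C} → (y , C) ∈ Δ → (y ≡ x × Γ ⊩ N ∶ C) ⊎ (y ≢ x × (y , C) ∈ Γ)

SubstCtx≤ : ℕ → Ctx → Ctx → ℕ → Term 0 → Set
SubstCtx≤ n Δ Γ x N =
  ∀ {y C} → (y , C) ∈ Δ → (y ≡ x × size C ≤ n × Γ ⊩ N ∶ C) ⊎ (y ≢ x × (y , C) ∈ Γ)

SubstCtx≤-∷ : ∀ {n Δ Γ x N w A} → SubstCtx≤ n Δ Γ x N → w ≢ x →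
              SubstCtx≤ n ((w , A) ∷ Δ) ((w , A) ∷ Γ) x N
SubstCtx≤-∷ h w≢x (here refl) = inj₂ (w≢x , here refl)
SubstCtx≤-∷ h w≢x (there q) with h q
... | inj₁ (y≡x , s , d) = inj₁ (y≡x , s , weaken there d)
... | inj₂ (y≢x , m)     = inj₂ (y≢x , there m)

SubstCtx≤-head : ∀ {n Γ x N C} → x ∉dom Γ → size C ≤ n → Γ ⊩ N ∶ C →
                 SubstCtx≤ n ((x , C) ∷ Γ) Γ x N
SubstCtx≤-head x∉ s d (here refl) = inj₁ (refl , s , d)
SubstCtx≤-head x∉ s d (there q)   = inj₂ (∉dom-≢ x∉ q , q)

size-⇒-≤ : ∀ {A₁ A₂ n} → size (A₁ ⇒ A₂) ≤ suc n → size A₁ ≤ n × size A₂ ≤ n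
size-⇒-≤ {A₁} {A₂} (s≤s s) =
  ≤-trans (m≤m+n (size A₁) (size A₂)) s , ≤-trans (m≤n+m (size A₂) (size A₁)) s

size-∩-≤ : ∀ {A₁ A₂ n} → size (A₁ ∩ A₂) ≤ n → size A₁ ≤ n × size A₂ ≤ n
size-∩-≤ {A₁} {A₂} s =
  ≤-trans (≤-trans (m≤m+n (size A₁) (size A₂)) (n≤1+n _)) s ,
  ≤-trans (≤-trans (m≤n+m (size A₂) (size A₁)) (n≤1+n _)) s

mutual
  substitution-≤ : ∀ n {Δ Γ x N P B} → Δ ⊩ P ∶ B → SubstCtx≤ n Δ Γ x N → Γ ⊩ fsub x N P ∶ B
  substitution-≤ n {x = x} {N} (ax m) h with h m
  ... | inj₁ (refl , _ , d) = cast (sym (fsub-self x N)) d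
  ... | inj₂ (y≢x , m′)     = cast (sym (fsub-other N y≢x)) (ax m′)
  substitution-≤ n {x = x} {N} (beta {M = M} {N = K} {Ns = Ns} d e) h =
    cast (sym (fsub-·* x N (app (lam M) K) Ns))
      (beta {M = fsub x N M} {Ns = map (fsub x N) Ns}
        (cast (trans (fsub-·* x N (inst M K) Ns) (cong (_·* map (fsub x N) Ns) (fsub-inst x N M K)))
          (substitution-≤ n d h))
        (substitution-≤ n e h))
  substitution-≤ n {x = x} {N} (r⇒ {M = M} L f) h =
    r⇒ (x ∷ L) λ w w∉ →
      cast (fsub-openT-other N M (w∉ ∘ here))
        (substitution-≤ n (f w (w∉ ∘ there)) (SubstCtx≤-∷ h (w∉ ∘ here)))
  substitution-≤ n {Γ = Γ} {x} {N} (l⇒ {N = K} {Ns = Ns} m d L f) h with h m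
  ... | inj₂ (y≢x , m′) =
    cast (sym (fsub-other·* N (K ∷ Ns) y≢x))
      (l⇒ {Ns = map (fsub x N) Ns} m′ (substitution-≤ n d h) (x ∷ L) λ w w∉ →
        cast (fsub-other·* N Ns (w∉ ∘ here))
          (substitution-≤ n (f w (w∉ ∘ there)) (SubstCtx≤-∷ h (w∉ ∘ here))))
  ... | inj₁ (refl , s , dN) =
    cast (sym (fsub-self·* x N (K ∷ Ns)))
      (⇒-elim·* n s dN (substitution-≤ n d h)
        (cast (fsub-other·* N Ns (name∉ ∘ here))
          (substitution-≤ n (f name (name∉ ∘ there)) (SubstCtx≤-∷ h (name∉ ∘ here))))
        name∉dom name∉FV)
    where open FreshName (freshName (x ∷ L) Γ (map (fsub x N) Ns))
  substitution-≤ n {Δ} {Γ} {x} {N} (l∩ {Ns = Ns} {A₁} {A₂} m d) h with h m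
  ... | inj₂ (y≢x , m′) =
    cast (sym (fsub-other·* N Ns y≢x))
      (l∩ {Ns = map (fsub x N) Ns} m′
        (cast (fsub-other·* N Ns y≢x) (substitution-≤ n d (SubstCtx≤-∷ (SubstCtx≤-∷ h y≢x) y≢x))))
  ... | inj₁ (refl , s , dN) = substitution-≤ n d h′
    where
    h′ : SubstCtx≤ n ((x , A₁) ∷ (x , A₂) ∷ Δ) Γ x N
    h′ (here refl)         = inj₁ (refl , proj₁ (size-∩-≤ s) , proj₁ (∩-inv dN))
    h′ (there (here refl)) = inj₁ (refl , proj₂ (size-∩-≤ s) , proj₂ (∩-inv dN))
    h′ (there (there q))   = h q
  substitution-≤ n (r∩ d e) h = r∩ (substitution-≤ n d h) (substitution-≤ n e h)

  ⇒-elim·* : ∀ n {Γ N M A₁ A₂ B w Ns} → size (A₁ ⇒ A₂) ≤ n →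
             Γ ⊩ N ∶ A₁ ⇒ A₂ → Γ ⊩ M ∶ A₁ → ((w , A₂) ∷ Γ) ⊩ fvar w ·* Ns ∶ B →
             w ∉dom Γ → All (λ L → w ∉ FV L) Ns → Γ ⊩ app N M ·* Ns ∶ B
  ⇒-elim·* (suc n) {N = N} {M} {w = w} {Ns} s dN dM d w∉ w∉Ns =
    cast (fsub-self·*-fresh w (app N M) Ns w∉Ns)
      (substitution-≤ n d (SubstCtx≤-head w∉ (proj₂ (size-⇒-≤ s))
        (⇒-elim n (proj₁ (size-⇒-≤ s)) dN dM)))

  ⇒-elim : ∀ n {Γ N M A₁ A₂} → size A₁ ≤ n → Γ ⊩ N ∶ A₁ ⇒ A₂ → Γ ⊩ M ∶ A₁ →
           Γ ⊩ app N M ∶ A₂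
  ⇒-elim n s (ax m) dM = l⇒ {Ns = []} m dM [] (λ _ _ → ax (here refl))
  ⇒-elim n {M = M} s (beta {M = M₀} {N = K} {Ns = Ks} d e) dM =
    cast (sym (·*-∷ʳ (app (lam M₀) K) Ks M))
      (beta {M = M₀} {Ns = Ks ∷ʳ M} (cast (·*-∷ʳ (inst M₀ K) Ks M) (⇒-elim n s d dM)) e)
  ⇒-elim n {M = M} s (l⇒ {x = u} {N = K} {Ns = Ks} m d L f) dM =
    cast (sym (·*-∷ʳ (app (fvar u) K) Ks M))
      (l⇒ {Ns = Ks ∷ʳ M} m d L λ w w∉ →
        cast (·*-∷ʳ (fvar w) Ks M) (⇒-elim n s (f w w∉) (weaken there dM)))
  ⇒-elim n {Γ} {M = M} s (r⇒ {M = M₀} L f) dM =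
    beta {M = M₀} {Ns = []}
      (cast (fsub-openT-self name M M₀ (All.head name∉FV))
        (substitution-≤ n (f name name∉) (SubstCtx≤-head name∉dom s dM)))
      dM
    where open FreshName (freshName L Γ (lam M₀ ∷ []))
  ⇒-elim n {M = M} s (l∩ {x = u} {Ns = Ks} m d) dM =
    cast (sym (·*-∷ʳ (fvar u) Ks M))
      (l∩ {Ns = Ks ∷ʳ M} m
        (cast (·*-∷ʳ (fvar u) Ks M) (⇒-elim n s d (weaken (there ∘ there) dM))))

weight : Ctx → ℕ
weight Δ = max 0 (map (size ∘ proj₂) Δ)

substitution : ∀ {Δ Γ x N P B} → Δ ⊩ P ∶ B → SubstCtx Δ Γ x N → Γ ⊩ fsub x N P ∶ B
substitution {Δ} {Γ} {x} {N} d h = substitution-≤ (weight Δ) d h′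
  where
  h′ : SubstCtx≤ (weight Δ) Δ Γ x N
  h′ q with h q
  ... | inj₁ (y≡x , dN) = inj₁ (y≡x , All.lookup (xs≤max 0 _) (∈-map⁺ (size ∘ proj₂) q) , dN)
  ... | inj₂ r          = inj₂ r

rename-head : ∀ {Γ x y A M B} → x ∉dom Γ → ((x , A) ∷ Γ) ⊩ M ∶ B →
              ((y , A) ∷ Γ) ⊩ fsub x (fvar y) M ∶ B
rename-head {Γ} {x} {y} {A} x∉ d = substitution d h
  where
  h : SubstCtx ((x , A) ∷ Γ) ((y , A) ∷ Γ) x (fvar y)
  h (here refl) = inj₁ (refl , ax (here refl))
  h (there q)   = inj₂ (∉dom-≢ x∉ q , there q)

-- Equivalence of the two calculi

∈⇒≋∷ : ∀ {p Γ} → p ∈ Γ → Γ ≋ (p ∷ Γ)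
∈⇒≋∷ {Γ = Γ} p∈ q = mk⇔ there absorb
  where
  absorb : q ∈ (_ ∷ Γ) → q ∈ Γ
  absorb (here refl) = p∈
  absorb (there q∈)  = q∈

⊩⇒⊢s : ∀ {Γ M A} → Γ ⊩ M ∶ A → Γ ⊢s M ∶ A
⊩⇒⊢s (ax m) = Ax m
⊩⇒⊢s (beta {M = M} {Ns = Ns} d e) = Beta {M = M} {Ns = Ns} (⊩⇒⊢s d) (⊩⇒⊢s e)
⊩⇒⊢s {Γ} (l⇒ {Ns = Ns} m d L f) =
  L⇒ {Ns = Ns} (∈⇒≋∷ m) (⊩⇒⊢s d) (⊩⇒⊢s (f name name∉)) name∉FV name∉dom
  where open FreshName (freshName L Γ Ns)
⊩⇒⊢s {Γ} (r⇒ {M = M} L f) =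
  R⇒ (All.head name∉FV) (⊩⇒⊢s (f name name∉)) name∉dom
  where open FreshName (freshName L Γ (lam M ∷ []))
⊩⇒⊢s (l∩ {Ns = Ns} m d) = L∩ {Ns = Ns} (∈⇒≋∷ m) (⊩⇒⊢s d)
⊩⇒⊢s (r∩ d e) = R∩ (⊩⇒⊢s d) (⊩⇒⊢s e)

-- Renaming its eigenvariable turns a derivation for one name into one for every name.
⊢s⇒⊩ : ∀ {Γ M A} → Γ ⊢s M ∶ A → Γ ⊩ M ∶ A
⊢s⇒⊩ (Ax m) = ax m
⊢s⇒⊩ (Beta {M = M} {Ns = Ns} d e) = beta {M = M} {Ns = Ns} (⊢s⇒⊩ d) (⊢s⇒⊩ e)
⊢s⇒⊩ (L⇒ {y = y} {Ns = Ns} Δ≋ d dy y∉Ns y∉) =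
  l⇒ {Ns = Ns} (from (Δ≋ _) (here refl)) (weaken (from (Δ≋ _) ∘ there) (⊢s⇒⊩ d)) [] λ w _ →
    weaken (∷⁺ʳ _ (from (Δ≋ _) ∘ there))
      (cast (fsub-self·*-fresh y (fvar w) Ns y∉Ns)
        (rename-head y∉ (⊢s⇒⊩ dy)))
⊢s⇒⊩ (R⇒ {x = x} {M} x∉ d x∉Γ) = r⇒ [] λ w _ →
  cast (fsub-openT-self x (fvar w) M x∉) (rename-head x∉Γ (⊢s⇒⊩ d))
⊢s⇒⊩ (L∩ {Ns = Ns} Δ≋ d) =
  l∩ {Ns = Ns} (from (Δ≋ _) (here refl)) (weaken (∷⁺ʳ _ (∷⁺ʳ _ (from (Δ≋ _) ∘ there))) (⊢s⇒⊩ d))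
⊢s⇒⊩ (R∩ d e) = r∩ (⊢s⇒⊩ d) (⊢s⇒⊩ e)

lemma4 : (Γ : Ctx) (x : ℕ) → x ∉dom Γ →
         (As : List Ty) → Unique As →
         (P N : Term 0) (B : Ty) →
         (map (λ A → (x , A)) As ++ Γ) ⊢s P ∶ B →
         (∀ A → A ∈ As → Γ ⊢s N ∶ A) →
         Γ ⊢s fsub x N P ∶ B
lemma4 Γ x x∉ As _ P N B dP dN = ⊩⇒⊢s (substitution (⊢s⇒⊩ dP) hyp)
  where
  hyp : SubstCtx (map (λ A → (x , A)) As ++ Γ) Γ x N
  hyp q with ∈-++⁻ (map (λ A → (x , A)) As) q
  ... | inj₂ q∈Γ = inj₂ (∉dom-≢ x∉ q∈Γ , q∈Γ)
  ... | inj₁ q∈x with ∈-map⁻ (λ A → (x , A)) q∈x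
  ...   | A , A∈ , refl = inj₁ (refl , ⊢s⇒⊩ (dN A A∈))
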